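{- Let $b,n$ be natural numbers with $1<n<b$, let $M$ be the $(n,b)$-mother graph, let $\{C_0,C_1,\ldots,C_m\}$ be the collection of (directed) cycles of $M$, and for each $j$ let $\Delta_j$ be the multi-image of $C_j$ in the $(n,b)$-Hoey-Sloane multigraph $\Delta$. Let $I$ be a multiset whose support is a subset of $\{0,1,\ldots,m\}$. If the multigraph union $\Delta_I=\biguplus_{j\in I}\Delta_j$ contains an Eulerian circuit (a closed walk using every multiedge of $\Delta_I$ exactly once) beginning and ending at the state $0$, then the multiset union $C_I=\biguplus_{j\in I}C_j$ of mother-graph cycles can be ordered into an $(n,b)$-permutiple string.
   Context: Base-$b$ digits are the integers $0,\ldots,b-1$, and $(d_k,\ldots,d_0)_b=\sum_{j=0}^k d_jb^j$. For integer $x$, $\lambda(x)$ is the least non-negative residue of $x$ mod $b$. The $(n,b)$-mother graph $M$ is the directed graph with vertex set the base-$b$ digits and edges the ordered pairs $(d_1,d_2)$ of digits with $\lambda(d_1+(b-n)d_2)\leq n-1$. A cycle of $M$ is a directed cycle (loops allowed), regarded as its set of edges. For every edge $(d_1,d_2)$ of $M$ there is a unique pair of integers $(c_1,c_2)$ with $0\le c_1,c_2\le n-1$ and $bc_2-c_1=nd_2-d_1$; we say $(d_1,d_2)$ induces the transition from state $c_1$ to state $c_2$. The $(n,b)$-Hoey-Sloane multigraph $\Delta$ has vertex set (states) $\{0,1,\ldots,n-1\}$ and, for each edge $(d_1,d_2)$ of $M$, one directed multiedge from $c_1$ to $c_2$ (the transition it induces) labeled $(d_1,d_2)$. For a cycle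 $C_j$ of $M$, its multi-image $\Delta_j$ is the sub-multigraph of $\Delta$ consisting of the multiedges whose labels lie in $C_j$ (with their endpoint states as vertices). For a multiset $I$ of indices, $C_I=\biguplus_{j\in I}C_j$ is the multiset union (each $C_j$ counted with its multiplicity in $I$), and $\Delta_I=\biguplus_{j\in I}\Delta_j$ is the multigraph union in which multiedges are counted with multiplicity. The language $L$ consists of the finite strings $s=(d_0,\hat d_0)(d_1,\hat d_1)\cdots(d_k,\hat d_k)$ of edges of $M$ for which there are states $c_0=0,c_1,\ldots,c_{k+1}=0$ in $\{0,\ldots,n-1\}$ with $(d_j,\hat d_j)$ inducing the transition from $c_j$ to $c_{j+1}$ for every $j$ (i.e. $bc_{j+1}-c_j=n\hat d_j-d_j$). An $(n,b)$-permutiple string is a member $s$ of $L$ for which there is a permutation $\sigma$ of $\{0,\ldots,k\}$ with $\hat d_j=d_{\sigma(j)}$ for all $j$, so that $(d_k,\ldots,d_0)_b=n\,(d_{\sigma(k)},\ldots,d_{\sigma(0)})_b$. "$C_I$ can be ordered into a permutiple string" means the elements of the multiset $C_I$, each used exactly as many times as its multiplicity, can be arranged in a sequence forming a permutiple string. -}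

module Defs where

open import Data.Nat using (ℕ; zero; suc; _+_; _*_; _∸_; _≤_; _<_; NonZero)
open import Data.Nat.DivMod using (_%_)
open import Data.Product using (Σ; _×_; _,_; proj₁; proj₂)
open import Data.List using (List; []; _∷_; _++_; [_]; zip; map; concat; length; lookup)
open import Data.List.Relation.Unary.All using (All)
open import Data.List.Relation.Unary.Unique.Propositional using (Unique)
open import Data.List.Relation.Binary.Permutation.Propositional using (_↭_)
open import Data.Fin.Permutation using (Permutation′; _⟨$⟩ʳ_)
open import Relation.Binary.PropositionalEquality using (_≡_; _≢_)

Edge : Set
Edge = ℕ × ℕ

-- (d₁ , d₂) is an edge of the (n,b)-mother graph:
-- d₁, d₂ are base-b digits and λ(d₁ + (b - n) d₂) ≤ n - 1.
-- (b - n is a natural number since n < b; λ(x) = x mod b.)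
MotherEdge : (n b : ℕ) → .{{NonZero b}} → Edge → Set
MotherEdge n b (d₁ , d₂) = d₁ < b × d₂ < b × ((d₁ + (b ∸ n) * d₂) % b ≤ n ∸ 1)

-- Edge (d₁ , d₂) induces the transition from state c₁ to state c₂:
-- 0 ≤ c₁, c₂ ≤ n - 1 and b c₂ - c₁ = n d₂ - d₁ (rearranged over ℕ).
Induces : (n b : ℕ) → Edge → ℕ → ℕ → Set
Induces n b (d₁ , d₂) c₁ c₂ = c₁ < n × c₂ < n × (b * c₂ + d₁ ≡ n * d₂ + c₁)

-- Edges of the directed cycle through the vertex sequence v₀ v₁ … v_{k-1}:
-- (v₀,v₁), (v₁,v₂), …, (v_{k-1},v₀)  (a loop (v₀,v₀) when k = 1).
cycleEdges : List ℕ → List Edge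
cycleEdges []       = []
cycleEdges (v ∷ vs) = zip (v ∷ vs) (vs ++ [ v ])

Cycle : (n b : ℕ) → .{{NonZero b}} → Set
Cycle n b = Σ (List ℕ) λ vs →
  (vs ≢ []) × Unique vs × All (λ v → v < b) vs × All (MotherEdge n b) (cycleEdges vs)

edgesOf : (n b : ℕ) → .{{_ : NonZero b}} → Cycle n b → List Edge
edgesOf n b (vs , _) = cycleEdges vs

CUnion : (n b : ℕ) → .{{_ : NonZero b}} → List (Cycle n b) → List Edge
CUnion n b I = concat (map (edgesOf n b) I)

-- A multiedge of the Hoey-Sloane multigraph: (source state, target state, label).
HSEdge : Set
HSEdge = ℕ × ℕ × Edge

label : HSEdge → Edge
label (_ , _ , e) = e

-- The multi-image Δ_j of a cycle: one multiedge per edge of C_j, carrying the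
-- transition that the label induces.
ValidHSEdge : (n b : ℕ) → HSEdge → Set
ValidHSEdge n b (c , c' , e) = Induces n b e c c'

Walk : (n b : ℕ) → ℕ → List HSEdge → ℕ → Set
Walk n b c []                   c' = c ≡ c'
Walk n b c ((s , t , e) ∷ ws)   c' = (c ≡ s) × ValidHSEdge n b (s , t , e) × Walk n b t ws c'

-- An Eulerian circuit of Δ_I beginning and ending at state 0: a nonempty closed
-- walk from 0 to 0 of multiedges of Δ whose labels use each multiedge of Δ_I
-- (i.e. each element of the multiset C_I) exactly once.
EulerianCircuitAt0 : (n b : ℕ) → .{{_ : NonZero b}} → List (Cycle n b) → Set
EulerianCircuitAt0 n b I = Σ (List HSEdge) λ ws →
  (ws ≢ []) × Walk n b 0 ws 0 × (map label ws ↭ CUnion n b I)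

Chain : (n b : ℕ) → ℕ → List Edge → ℕ → Set
Chain n b c []       c' = c ≡ c'
Chain n b c (e ∷ es) c' = Σ ℕ λ c₁ → Induces n b e c c₁ × Chain n b c₁ es c'

InL : (n b : ℕ) → .{{_ : NonZero b}} → List Edge → Set
InL n b s = (s ≢ []) × All (MotherEdge n b) s × Chain n b 0 s 0

PermutipleString : (n b : ℕ) → .{{_ : NonZero b}} → List Edge → Set
PermutipleString n b s = InL n b s ×
  Σ (Permutation′ (length s)) λ σ →
    ∀ j → proj₂ (lookup s j) ≡ proj₁ (lookup s (σ ⟨$⟩ʳ j))

OrderableIntoPermutiple : (n b : ℕ) → .{{_ : NonZero b}} → List (Cycle n b) → Set
OrderableIntoPermutiple n b I = Σ (List Edge) λ s → (s ↭ CUnion n b I) × PermutipleString n b s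

module Submission where

open import Defs
open import Data.Nat using (ℕ; _<_; NonZero; pred)
open import Data.List using (List; []; _∷_; _++_; [_]; zip; map; length; lookup)
open import Data.List.Properties using (map-++; length-map)
open import Data.List.Relation.Unary.All using (All; [])
import Data.List.Relation.Unary.All.Properties as All
open import Data.List.Relation.Binary.Permutation.Propositional using (_↭_; ↭-refl; ↭-sym; ↭-trans; ↭⇒↭ₛ)
open import Data.List.Relation.Binary.Permutation.Propositional.Properties using (++-comm; ++⁺; map⁺; All-resp-↭)
open import Data.List.Relation.Binary.Permutation.Homogeneous using (onIndices)
import Data.List.Relation.Binary.Permutation.Setoid.Properties as PermProperties
open import Data.Product using (Σ; _,_; proj₁; proj₂)
open import Data.Fin using (Fin; cast; zero; suc)
open import Data.Fin.Permutation using (Permutation′; _⟨$⟩ʳ_; _∘ₚ_; cast-id)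
open import Data.Empty using (⊥-elim)
open import Relation.Binary.PropositionalEquality using (_≡_; _≢_; refl; sym; cong; setoid; module ≡-Reasoning)

-- The Eulerian circuit, read through its labels, is a string of mother-graph
-- edges whose induced transitions chain from state 0 back to state 0, i.e. a
-- member of L, and it is a rearrangement of C_I.  Every cycle of M has the same
-- multiset of first and second digits, hence so does C_I and so does the string;
-- a permutation matching second digits to first digits is exactly the witness σ
-- of a permutiple string.

lookup-map : ∀ {A B : Set} (f : A → B) (xs : List A)
  .(eq : length xs ≡ length (map f xs)) (i : Fin (length xs)) →
  lookup (map f xs) (cast eq i) ≡ f (lookup xs i)
lookup-map f (x ∷ xs) eq zero    = refl
lookup-map f (x ∷ xs) eq (suc i) = lookup-map f xs (cong pred eq) i

lookup-map′ : ∀ {A B : Set} (f : A → B) (xs : List A)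
  .(eq : length (map f xs) ≡ length xs) (i : Fin (length (map f xs))) →
  lookup (map f xs) i ≡ f (lookup xs (cast eq i))
lookup-map′ f (x ∷ xs) eq zero    = refl
lookup-map′ f (x ∷ xs) eq (suc i) = lookup-map′ f xs (cong pred eq) i

map-↭⇒lookup-permutation : ∀ {A B : Set} (f g : A → B) (xs : List A) →
  map f xs ↭ map g xs →
  Σ (Permutation′ (length xs)) λ σ → ∀ i → f (lookup xs i) ≡ g (lookup xs (σ ⟨$⟩ʳ i))
map-↭⇒lookup-permutation {B = B} f g xs fxs↭gxs = σ , matches
  where
  f-len : length xs ≡ length (map f xs)
  f-len = sym (length-map f xs)
  g-len : length (map g xs) ≡ length xs
  g-len = length-map g xs
  σ : Permutation′ (length xs)
  σ = cast-id f-len ∘ₚ (onIndices (↭⇒↭ₛ fxs↭gxs) ∘ₚ cast-id g-len)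
  matches : ∀ i → f (lookup xs i) ≡ g (lookup xs (σ ⟨$⟩ʳ i))
  matches i = begin
    f (lookup xs i)                                             ≡⟨ sym (lookup-map f xs f-len i) ⟩
    lookup (map f xs) (cast f-len i)                            ≡⟨ onIndices-lookup (↭⇒↭ₛ fxs↭gxs) _ ⟩
    lookup (map g xs) (onIndices (↭⇒↭ₛ fxs↭gxs) ⟨$⟩ʳ cast f-len i) ≡⟨ lookup-map′ g xs g-len _ ⟩
    g (lookup xs (σ ⟨$⟩ʳ i))                                    ∎
    where open ≡-Reasoning
          open PermProperties (setoid B) using (onIndices-lookup)

Balanced : List Edge → Set
Balanced es = map proj₂ es ↭ map proj₁ es

++-balanced : ∀ {es fs} → Balanced es → Balanced fs → Balanced (es ++ fs)
++-balanced {es} {fs} es-bal fs-bal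
  rewrite map-++ proj₂ es fs | map-++ proj₁ es fs = ++⁺ es-bal fs-bal

balanced-resp-↭ : ∀ {es fs} → es ↭ fs → Balanced fs → Balanced es
balanced-resp-↭ es↭fs fs-bal =
  ↭-trans (map⁺ proj₂ es↭fs) (↭-trans fs-bal (map⁺ proj₁ (↭-sym es↭fs)))

map-proj₁-zip-rotate : ∀ (x : ℕ) xs y → map proj₁ (zip (x ∷ xs) (xs ++ [ y ])) ≡ x ∷ xs
map-proj₁-zip-rotate x []        y = refl
map-proj₁-zip-rotate x (x′ ∷ xs) y = cong (x ∷_) (map-proj₁-zip-rotate x′ xs y)

map-proj₂-zip-rotate : ∀ (x : ℕ) xs y → map proj₂ (zip (x ∷ xs) (xs ++ [ y ])) ≡ xs ++ [ y ]
map-proj₂-zip-rotate x []        y = refl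
map-proj₂-zip-rotate x (x′ ∷ xs) y = cong (x′ ∷_) (map-proj₂-zip-rotate x′ xs y)

cycleEdges-balanced : ∀ vs → Balanced (cycleEdges vs)
cycleEdges-balanced []       = ↭-refl
cycleEdges-balanced (v ∷ vs)
  rewrite map-proj₁-zip-rotate v vs v | map-proj₂-zip-rotate v vs v = ++-comm vs [ v ]

CUnion-balanced : ∀ n b .{{_ : NonZero b}} (I : List (Cycle n b)) → Balanced (CUnion n b I)
CUnion-balanced n b []             = ↭-refl
CUnion-balanced n b ((vs , _) ∷ I) = ++-balanced (cycleEdges-balanced vs) (CUnion-balanced n b I)

CUnion-motherEdges : ∀ n b .{{_ : NonZero b}} (I : List (Cycle n b)) →
  All (MotherEdge n b) (CUnion n b I)
CUnion-motherEdges n b []                             = []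
CUnion-motherEdges n b ((_ , _ , _ , _ , edges) ∷ I) = All.++⁺ edges (CUnion-motherEdges n b I)

walk⇒chain : ∀ n b c ws c′ → Walk n b c ws c′ → Chain n b c (map label ws) c′
walk⇒chain n b c []                  c′ c≡c′              = c≡c′
walk⇒chain n b c ((_ , t , _) ∷ ws) c′ (refl , step , walk) = t , step , walk⇒chain n b t ws c′ walk

map-≢-[] : ∀ {A B : Set} (f : A → B) (xs : List A) → xs ≢ [] → map f xs ≢ []
map-≢-[] f []      xs≢[] _  = ⊥-elim (xs≢[] refl)
map-≢-[] f (_ ∷ _) _     ()

theorem4p2 : (n b : ℕ) → .{{_ : NonZero b}} → 1 < n → n < b →
    (I : List (Cycle n b)) →
    EulerianCircuitAt0 n b I →
    OrderableIntoPermutiple n b I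
theorem4p2 n b _ _ I (ws , ws≢[] , walk , labels↭C) =
  s , labels↭C , (s∈L , map-↭⇒lookup-permutation proj₂ proj₁ s s-balanced)
  where
  s = map label ws
  s∈L : InL n b s
  s∈L = map-≢-[] label ws ws≢[]
      , All-resp-↭ (↭-sym labels↭C) (CUnion-motherEdges n b I)
      , walk⇒chain n b 0 ws 0 walk
  s-balanced : Balanced s
  s-balanced = balanced-resp-↭ labels↭C (CUnion-balanced n b I)
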